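{- Let $\sigma\in Av(T_1)$. If $\Phi_1(\sigma)$ is a Dyck path, then $asc(\sigma)$ equals the number of occurrences of the factor $DU$ (valleys) in $\Phi_1(\sigma)$, plus the number of occurrences of the factor $DDD$ (triple descents, counted with overlaps) in $\Phi_1(\sigma)$, plus $1$ if $\Phi_1(\sigma)$ is nonempty (its final down step counts as a valley). If $\Phi_1(\sigma)$ is not a Dyck path, then $asc(\sigma)$ equals the number of valleys $DU$ whose down step precedes the cut step, plus the number of occurrences of $DDD$ preceding the cut step, plus the number of down steps following the cut step in $\Phi_1(\sigma)$.
   Context: A permutation $\sigma$ avoids $\tau$ if no subsequence of $\sigma$ has the same relative order as $\tau$. $T_1=\{3214,3241,4213,4231\}$, $Av(T_1)$ is the set of permutations avoiding all four patterns, $S_n(T_1)=Av(T_1)\cap S_n$. $asc(\sigma)$ is the number of ascents of $\sigma$, i.e. of positions $i$ with $\sigma(i)<\sigma(i+1)$. A Dyck prefix is a lattice path from the origin with steps $U=(1,1)$, $D=(1,-1)$ never going below the $x$-axis (a word in $U,D$); a Dyck path is one ending on the $x$-axis. The map $\Phi_1$ on $Av(T_1)$: $\Phi_1(1)$ is the empty path; for $n\ge1$ and $\sigma\in S_{n+1}(T_1)$, write $\sigma=M_1w_1\cdots M_kw_k$ with $M_1<\cdots<M_k=n+1$ the left-to-right maxima (entries larger than all preceding ones) and $w_i$ possibly empty words of lengths $l_i$, $M_0=0$. If $w_k$ is empty, $\Phi_1(\sigma)=U^{M_1-M_0}D^{l_1+1}\cdots U^{M_{k-1}-M_{k-2}}D^{l_{k-1}+1}$;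 if $w_k=x_1\cdots x_{l_k}$ is nonempty, $\Phi_1(\sigma)=U^{M_1-M_0}D^{l_1+1}\cdots U^{M_{k-1}-M_{k-2}}D^{l_{k-1}+1}U^{M_k-M_{k-1}}Q_1\cdots Q_{l_k-1}$ with $Q_j=U$ if $x_j=\max\{x_j,\dots,x_{l_k}\}$ and $Q_j=D$ otherwise. For $\sigma\in S_{n+1}(T_1)$, the cut step of $\Phi_1(\sigma)$ is its $(n+1)$-th up step, which exists exactly when $\Phi_1(\sigma)$ is not a Dyck path. -}

module Defs where

open import Data.Nat using (ℕ; zero; suc; _+_; _∸_; _<_; _<ᵇ_)
open import Data.Bool using (Bool; true; false; if_then_else_)
open import Data.List using (List; []; _∷_; _++_; length; map; upTo; replicate; reverse)
open import Data.List.Relation.Binary.Permutation.Propositional using (_↭_)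
open import Data.List.Relation.Binary.Sublist.Propositional using (_⊆_)
open import Data.List.Relation.Binary.Pointwise using (Pointwise)
open import Data.Unit using (⊤)
open import Data.Empty using (⊥)
open import Data.Product using (_×_; _,_; ∃)
open import Function.Bundles using (_⇔_)
open import Relation.Nullary using (¬_)
open import Relation.Binary.PropositionalEquality using (_≡_)

IsPerm : List ℕ → Set
IsPerm σ = σ ↭ map suc (upTo (length σ))

OrderIso : List ℕ → List ℕ → Set
OrderIso [] [] = ⊤
OrderIso [] (_ ∷ _) = ⊥
OrderIso (_ ∷ _) [] = ⊥
OrderIso (x ∷ xs) (y ∷ ys) =
  Pointwise (λ x' y' → ((x < x') ⇔ (y < y')) × ((x' < x) ⇔ (y' < y))) xs ys
  × OrderIso xs ys

Contains : List ℕ → List ℕ → Set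
Contains σ τ = ∃ λ s → (s ⊆ σ) × OrderIso s τ

Avoids : List ℕ → List ℕ → Set
Avoids σ τ = ¬ Contains σ τ

p3214 p3241 p4213 p4231 : List ℕ
p3214 = 3 ∷ 2 ∷ 1 ∷ 4 ∷ []
p3241 = 3 ∷ 2 ∷ 4 ∷ 1 ∷ []
p4213 = 4 ∷ 2 ∷ 1 ∷ 3 ∷ []
p4231 = 4 ∷ 2 ∷ 3 ∷ 1 ∷ []

InAvT1 : List ℕ → Set
InAvT1 σ = IsPerm σ × Avoids σ p3214 × Avoids σ p3241 × Avoids σ p4213 × Avoids σ p4231

asc : List ℕ → ℕ
asc [] = 0
asc (x ∷ []) = 0
asc (x ∷ y ∷ ys) = (if x <ᵇ y then 1 else 0) + asc (y ∷ ys)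

data Step : Set where
  U D : Step

_≟ₛ_ : Step → Step → Bool
U ≟ₛ U = true
D ≟ₛ D = true
_ ≟ₛ _ = false

count : Step → List Step → ℕ
count s [] = 0
count s (t ∷ ts) = (if s ≟ₛ t then 1 else 0) + count s ts

IsDyckPrefix : List Step → Set
IsDyckPrefix p = ∀ q r → p ≡ q ++ r → Data.Nat._≤_ (count D q) (count U q)

IsDyckPath : List Step → Set
IsDyckPath p = IsDyckPrefix p × count U p ≡ count D p

isPrefixOf : List Step → List Step → Bool
isPrefixOf [] _ = true
isPrefixOf (_ ∷ _) [] = false
isPrefixOf (s ∷ f) (t ∷ p) = if s ≟ₛ t then isPrefixOf f p else false

occurrences : List Step → List Step → ℕ
occurrences f [] = if isPrefixOf f [] then 1 else 0
occurrences f (t ∷ p) = (if isPrefixOf f (t ∷ p) then 1 else 0) + occurrences f p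

valleys : List Step → ℕ
valleys = occurrences (D ∷ U ∷ [])

tripleDescents : List Step → ℕ
tripleDescents = occurrences (D ∷ D ∷ D ∷ [])

-- decomposition σ = M₁w₁⋯M_kw_k into left-to-right maxima and words
blocksFrom : ℕ → List ℕ → List ℕ → List (ℕ × List ℕ)
blocksFrom M acc [] = (M , reverse acc) ∷ []
blocksFrom M acc (y ∷ ys) =
  if M <ᵇ y then (M , reverse acc) ∷ blocksFrom y [] ys
            else blocksFrom M (y ∷ acc) ys

blocks : List ℕ → List (ℕ × List ℕ)
blocks [] = []
blocks (x ∷ xs) = blocksFrom x [] xs

allBelow : ℕ → List ℕ → Bool
allBelow x [] = true
allBelow x (z ∷ zs) = if z <ᵇ x then allBelow x zs else false

Qword : List ℕ → List Step
Qword [] = []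
Qword (x ∷ []) = []
Qword (x ∷ y ∷ ys) = (if allBelow x (y ∷ ys) then U else D) ∷ Qword (y ∷ ys)

-- prev = M_{i-1}
pathBlocks : ℕ → List (ℕ × List ℕ) → List Step
pathBlocks prev [] = []
pathBlocks prev ((M , []) ∷ []) = []
pathBlocks prev ((M , (x ∷ w)) ∷ []) = replicate (M ∸ prev) U ++ Qword (x ∷ w)
pathBlocks prev ((M , w) ∷ (b ∷ bs)) =
  replicate (M ∸ prev) U ++ replicate (length w + 1) D ++ pathBlocks M (b ∷ bs)

Φ₁ : List ℕ → List Step
Φ₁ σ = pathBlocks 0 (blocks σ)

isNonempty : List Step → ℕ
isNonempty [] = 0
isNonempty (_ ∷ _) = 1

module Submission where

-- Write σ = M₁w₁⋯M_kw_k. Avoiding 3214 forces every non-final word w_i to increase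
-- (a descent x > y in w_i would give the occurrence M_i x y M_{i+1}), so the block M_iw_i
-- contributes |w_i| ∸ 1 ascents inside w_i plus the ascent into M_{i+1}. On the path side
-- the same block gives the mountain U^(M_i−M_{i−1}) D^(|w_i|+1): up-runs contain no DU or
-- DDD, and a down-run of length l+1 followed by an up step (or by the end of the path)
-- contains l ∸ 1 factors DDD and one valley. Avoiding 4213 makes every descent top of the
-- final word larger than all later entries, so Q_j = D exactly at the ascents of w_k.
-- Summing block by block gives the Dyck formula when w_k is empty and the cut formula
-- otherwise (the cut step is the last U of the final up-run).
-- It remains to see that Φ₁(σ) is a Dyck path exactly when w_k is empty: then the path has
-- n down steps, at most n up steps, and it never goes below the axis because the entries up
-- to w_i are distinct values in {1,…,M_i} (pigeonhole); if w_k is nonempty the path has at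
-- least n + 1 up steps but at most n − 1 down steps.

open import Defs
open import Data.Nat using (ℕ; zero; suc; _+_; _∸_; _<_; _≤_; _<ᵇ_; z≤n; s≤s)
open import Data.Nat.Properties
open import Data.Nat.Tactic.RingSolver using (solve-∀)
open import Data.Bool using (true; false; if_then_else_; T)
open import Data.List using (List; []; _∷_; _++_; length; map; upTo; replicate; reverse)
open import Data.List.Properties using (++-assoc; ++-identityʳ; ∷-injectiveʳ; unfold-reverse; length-++; length-map; length-upTo)
open import Data.List.Relation.Unary.All as All using (All; []; _∷_)
open import Data.List.Relation.Unary.All.Properties using () renaming (++⁺ to All-++⁺)
open import Data.List.Relation.Unary.AllPairs using ([]; _∷_)
open import Data.List.Relation.Unary.Any using (here; there)
open import Data.List.Relation.Unary.Linked using (Linked; []; [-]; _∷_)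
open import Data.List.Relation.Unary.Unique.Propositional using (Unique)
import Data.List.Relation.Unary.Unique.Propositional.Properties as Unique
open import Data.List.Relation.Binary.Permutation.Propositional using (_↭_; ↭-sym; ↭⇒↭ₛ)
open import Data.List.Relation.Binary.Permutation.Propositional.Properties
  using (∈-resp-↭; All-resp-↭; shift; ↭-reverse; ↭-length)
open import Data.List.Relation.Binary.Permutation.Setoid.Properties using (Unique-resp-↭)
open import Data.List.Relation.Binary.Sublist.Propositional using (_⊆_; []; _∷_; _∷ʳ_; ⊆-refl; ⊆-trans; minimum)
open import Data.List.Relation.Binary.Sublist.Propositional.Properties using (All-resp-⊆; ++⁺ˡ; ++⁺ʳ; ++⁺)
open import Data.List.Membership.Propositional using (_∈_)
open import Data.List.Membership.Propositional.Properties using (∈-map⁺; ∈-map⁻; ∈-upTo⁺; ∈-upTo⁻; ∈-∃++; ∈-++⁺ʳ)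
open import Data.List.Relation.Binary.Pointwise using ([]; _∷_)
open import Data.Product using (_×_; _,_; ∃₂; proj₁; proj₂)
open import Data.Unit using (tt)
open import Data.Empty using (⊥-elim)
open import Function.Bundles using (_⇔_; mk⇔)
open import Relation.Binary.Definitions using (tri<; tri≈; tri>)
open import Relation.Nullary using (¬_)
open import Relation.Binary.PropositionalEquality
open import Relation.Binary.PropositionalEquality.Properties using (setoid)
open ≡-Reasoning

unique-⊆ : ∀ {A : Set} {xs ys : List A} → xs ⊆ ys → Unique ys → Unique xs
unique-⊆ [] _ = []
unique-⊆ (_ ∷ʳ xs⊆ys) (_ ∷ u) = unique-⊆ xs⊆ys u
unique-⊆ (refl ∷ xs⊆ys) (y∉ys ∷ u) = All-resp-⊆ xs⊆ys y∉ys ∷ unique-⊆ xs⊆ys u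

avoids-⊆ : ∀ {xs ys τ} → xs ⊆ ys → Avoids ys τ → Avoids xs τ
avoids-⊆ xs⊆ys av (s , s⊆xs , iso) = av (s , ⊆-trans s⊆xs xs⊆ys , iso)

suffix-⊆ : ∀ (M : ℕ) w {r} → r ⊆ M ∷ w ++ r
suffix-⊆ M w = M ∷ʳ ++⁺ˡ w ⊆-refl

unique-length-≤ : ∀ {A : Set} {xs ys : List A} → Unique xs → All (_∈ ys) xs → length xs ≤ length ys
unique-length-≤ [] [] = z≤n
unique-length-≤ {xs = x ∷ xs} (x∉xs ∷ u) (x∈ys ∷ xs∈ys) with ∈-∃++ x∈ys
... | ys₁ , ys₂ , refl =
  ≤-trans (s≤s (unique-length-≤ u (All.zipWith remove-x (x∉xs , xs∈ys))))
          (≤-reflexive (sym (↭-length (shift x ys₁ ys₂))))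
  where
    remove-x : ∀ {z} → (x ≢ z) × (z ∈ ys₁ ++ x ∷ ys₂) → z ∈ ys₁ ++ ys₂
    remove-x (x≢z , z∈) with ∈-resp-↭ (shift x ys₁ ys₂) z∈
    ... | here z≡x = ⊥-elim (x≢z (sym z≡x))
    ... | there z∈rest = z∈rest

unique-bounded-length : ∀ {m} {xs : List ℕ} → Unique xs → All (λ x → 0 < x × x ≤ m) xs → length xs ≤ m
unique-bounded-length {m} u bounded =
  subst (_ ≤_) (trans (length-map suc (upTo m)) (length-upTo m))
        (unique-length-≤ u (All.map in-range bounded))
  where
    in-range : ∀ {x} → 0 < x × x ≤ m → x ∈ map suc (upTo m)
    in-range {suc x} (_ , x<m) = ∈-map⁺ suc (∈-upTo⁺ x<m)

perm-range : ∀ {σ N x} → σ ↭ map suc (upTo N) → x ∈ σ → 0 < x × x ≤ N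
perm-range σ↭ x∈σ with ∈-map⁻ suc (∈-resp-↭ σ↭ x∈σ)
... | i , i∈ , refl = s≤s z≤n , ∈-upTo⁻ i∈

perm-unique : ∀ {σ N} → σ ↭ map suc (upTo N) → Unique σ
perm-unique {N = N} σ↭ =
  Unique-resp-↭ (setoid ℕ) (↭⇒↭ₛ (↭-sym σ↭)) (Unique.map⁺ suc-injective (Unique.upTo⁺ N))

perm-top : ∀ {σ n} → σ ↭ map suc (upTo (suc n)) → suc n ∈ σ
perm-top σ↭ = ∈-resp-↭ (↭-sym σ↭) (∈-map⁺ suc (∈-upTo⁺ (n<1+n _)))

-- Ascents

<ᵇ-true : ∀ {a b} → a < b → (a <ᵇ b) ≡ true
<ᵇ-true {zero} (s≤s _) = refl
<ᵇ-true {suc a} (s≤s a<b) = <ᵇ-true a<b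

<ᵇ-false : ∀ {a b} → b ≤ a → (a <ᵇ b) ≡ false
<ᵇ-false z≤n = refl
<ᵇ-false (s≤s b≤a) = <ᵇ-false b≤a

asc-up : ∀ {x y} ys → x < y → asc (x ∷ y ∷ ys) ≡ suc (asc (y ∷ ys))
asc-up _ x<y rewrite <ᵇ-true x<y = refl

asc-down : ∀ {x y} ys → y ≤ x → asc (x ∷ y ∷ ys) ≡ asc (y ∷ ys)
asc-down _ y≤x rewrite <ᵇ-false y≤x = refl

asc-below-head : ∀ {M} w → All (_< M) w → asc (M ∷ w) ≡ asc w
asc-below-head [] _ = refl
asc-below-head (_ ∷ w) (x<M ∷ _) = asc-down w (<⇒≤ x<M)

asc-increasing : ∀ {w} → Linked _<_ w → asc w ≡ length w ∸ 1
asc-increasing [] = refl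
asc-increasing [-] = refl
asc-increasing (_∷_ {xs = ys} x<y increasing) = trans (asc-up ys x<y) (cong suc (asc-increasing increasing))

asc-join : ∀ x xs {y} ys → All (_< y) (x ∷ xs) → asc (x ∷ xs ++ y ∷ ys) ≡ asc (x ∷ xs) + 1 + asc (y ∷ ys)
asc-join x [] ys (x<y ∷ []) = asc-up ys x<y
asc-join x (x′ ∷ xs) {y} ys (_ ∷ below) = begin
    e + asc (x′ ∷ xs ++ y ∷ ys)
  ≡⟨ cong (e +_) (asc-join x′ xs ys below) ⟩
    e + (asc (x′ ∷ xs) + 1 + asc (y ∷ ys))
  ≡⟨ sym (+-assoc e (asc (x′ ∷ xs) + 1) (asc (y ∷ ys))) ⟩
    e + (asc (x′ ∷ xs) + 1) + asc (y ∷ ys)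
  ≡⟨ cong (_+ asc (y ∷ ys)) (sym (+-assoc e (asc (x′ ∷ xs)) 1)) ⟩
    e + asc (x′ ∷ xs) + 1 + asc (y ∷ ys)
  ∎
  where e = if x <ᵇ x′ then 1 else 0

-- Factor counts in lattice paths

++-assoc₃ : ∀ {A : Set} (x y z t : List A) → (x ++ y ++ z) ++ t ≡ x ++ y ++ z ++ t
++-assoc₃ x y z t = trans (++-assoc x (y ++ z) t) (cong (x ++_) (++-assoc y z t))

data StartsUp : List Step → Set where
  empty : StartsUp []
  up    : ∀ {q} → StartsUp (U ∷ q)

startsUp-before : ∀ a {b} → StartsUp (a ++ U ∷ b) → StartsUp a
startsUp-before [] _ = empty
startsUp-before (U ∷ _) up = up

startsUp-through : ∀ a {b} → StartsUp (a ++ U ∷ b) → StartsUp (a ++ U ∷ [])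
startsUp-through [] _ = up
startsUp-through (U ∷ _) up = up

startsUp-Uᵏ : ∀ {k} q → 0 < k → StartsUp (replicate k U ++ q)
startsUp-Uᵏ {suc k} _ _ = up

isNonempty-∷ : ∀ p s q → isNonempty (p ++ s ∷ q) ≡ 1
isNonempty-∷ [] _ _ = refl
isNonempty-∷ (_ ∷ _) _ _ = refl

count-++ : ∀ s p q → count s (p ++ q) ≡ count s p + count s q
count-++ s [] q = refl
count-++ s (t ∷ p) q = begin
    e + count s (p ++ q)     ≡⟨ cong (e +_) (count-++ s p q) ⟩
    e + (count s p + count s q) ≡⟨ sym (+-assoc e (count s p) (count s q)) ⟩
    e + count s p + count s q ∎
  where e = if s ≟ₛ t then 1 else 0

countU+countD : ∀ p → count U p + count D p ≡ length p
countU+countD [] = refl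
countU+countD (U ∷ p) = cong suc (countU+countD p)
countU+countD (D ∷ p) = trans (+-suc (count U p) (count D p)) (cong suc (countU+countD p))

countU-Uᵏ : ∀ k p → count U (replicate k U ++ p) ≡ k + count U p
countU-Uᵏ zero p = refl
countU-Uᵏ (suc k) p = cong suc (countU-Uᵏ k p)

countD-Uᵏ : ∀ k p → count D (replicate k U ++ p) ≡ count D p
countD-Uᵏ zero p = refl
countD-Uᵏ (suc k) p = countD-Uᵏ k p

countU-Dᵏ : ∀ k p → count U (replicate k D ++ p) ≡ count U p
countU-Dᵏ zero p = refl
countU-Dᵏ (suc k) p = countU-Dᵏ k p

countD-Dᵏ : ∀ k p → count D (replicate k D ++ p) ≡ k + count D p
countD-Dᵏ zero p = refl
countD-Dᵏ (suc k) p = cong suc (countD-Dᵏ k p)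

occurrences-Uᵏ : ∀ f k p → occurrences (D ∷ f) (replicate k U ++ p) ≡ occurrences (D ∷ f) p
occurrences-Uᵏ f zero p = refl
occurrences-Uᵏ f (suc k) p = occurrences-Uᵏ f k p

valleys-Dᵏ : ∀ l {p} → StartsUp p → valleys (replicate (suc l) D ++ p) ≡ isNonempty p + valleys p
valleys-Dᵏ zero empty = refl
valleys-Dᵏ zero up = refl
valleys-Dᵏ (suc l) s = valleys-Dᵏ l s

tripleDescents-Dᵏ : ∀ l {p} → StartsUp p → tripleDescents (replicate (suc l) D ++ p) ≡ l ∸ 1 + tripleDescents p
tripleDescents-Dᵏ zero empty = refl
tripleDescents-Dᵏ zero up = refl
tripleDescents-Dᵏ (suc zero) empty = refl
tripleDescents-Dᵏ (suc zero) up = refl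
tripleDescents-Dᵏ (suc (suc l)) s = cong suc (tripleDescents-Dᵏ (suc l) s)

dyckStat : List Step → ℕ
dyckStat q = valleys q + tripleDescents q + isNonempty q

cutStat : List Step → List Step → ℕ
cutStat a b = valleys (a ++ U ∷ []) + tripleDescents a + count D b

dyckStat-mountain : ∀ d l {q} → StartsUp q →
  dyckStat (replicate d U ++ replicate (suc l) D ++ q) ≡ l ∸ 1 + 1 + dyckStat q
dyckStat-mountain d l {q} s = begin
    dyckStat (replicate d U ++ replicate (suc l) D ++ q)
  ≡⟨ cong₂ _+_ (cong₂ _+_ (trans (occurrences-Uᵏ _ d _) (valleys-Dᵏ l s))
                          (trans (occurrences-Uᵏ _ d _) (tripleDescents-Dᵏ l s)))
               (isNonempty-∷ (replicate d U) D _) ⟩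
    (isNonempty q + valleys q) + (l ∸ 1 + tripleDescents q) + 1
  ≡⟨ rearrange (isNonempty q) (valleys q) (l ∸ 1) (tripleDescents q) ⟩
    l ∸ 1 + 1 + dyckStat q
  ∎
  where
    rearrange : ∀ n v t t′ → (n + v) + (t + t′) + 1 ≡ t + 1 + (v + t′ + n)
    rearrange = solve-∀

cutStat-mountain : ∀ d l a b → StartsUp (a ++ U ∷ b) →
  cutStat (replicate d U ++ replicate (suc l) D ++ a) b ≡ l ∸ 1 + 1 + cutStat a b
cutStat-mountain d l a b s = begin
    valleys ((X ++ Y ++ a) ++ U ∷ []) + tripleDescents (X ++ Y ++ a) + count D b
  ≡⟨ cong (λ q → valleys q + tripleDescents (X ++ Y ++ a) + count D b) (++-assoc₃ X Y a (U ∷ [])) ⟩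
    valleys (X ++ Y ++ a ++ U ∷ []) + tripleDescents (X ++ Y ++ a) + count D b
  ≡⟨ cong (_+ count D b) (cong₂ _+_
       (trans (occurrences-Uᵏ _ d _) (trans (valleys-Dᵏ l (startsUp-through a s))
                                            (cong (_+ valleys (a ++ U ∷ [])) (isNonempty-∷ a U []))))
       (trans (occurrences-Uᵏ _ d _) (tripleDescents-Dᵏ l (startsUp-before a s)))) ⟩
    (1 + valleys (a ++ U ∷ [])) + (l ∸ 1 + tripleDescents a) + count D b
  ≡⟨ rearrange (valleys (a ++ U ∷ [])) (tripleDescents a) (l ∸ 1) (count D b) ⟩
    l ∸ 1 + 1 + cutStat a b
  ∎
  where
    X = replicate d U
    Y = replicate (suc l) D
    rearrange : ∀ v t t′ c → (1 + v) + (t′ + t) + c ≡ t′ + 1 + (v + t + c)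
    rearrange = solve-∀

-- Block decompositions σ = M₁w₁⋯M_kw_k

flatten : List (ℕ × List ℕ) → List ℕ
flatten [] = []
flatten ((M , w) ∷ bs) = M ∷ w ++ flatten bs

lastMax : List (ℕ × List ℕ) → ℕ
lastMax [] = 0
lastMax ((M , _) ∷ []) = M
lastMax (_ ∷ b ∷ bs) = lastMax (b ∷ bs)

lastWord : List (ℕ × List ℕ) → List ℕ
lastWord [] = []
lastWord ((_ , w) ∷ []) = w
lastWord (_ ∷ b ∷ bs) = lastWord (b ∷ bs)

-- Blocks p bs: the maxima of bs increase starting above p, and every word lies below its
-- maximum; this is the shape of the left-to-right-maxima decomposition.
data Blocks : ℕ → List (ℕ × List ℕ) → Set where
  final : ∀ {p M w} → p < M → All (_< M) w → Blocks p ((M , w) ∷ [])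
  block : ∀ {p M w M′ w′ bs} → p < M → All (_< M) w →
          Blocks M ((M′ , w′) ∷ bs) → Blocks p ((M , w) ∷ (M′ , w′) ∷ bs)

-- The constructor block, for a rest whose shape is not known in advance.
block′ : ∀ {p M w bs} → p < M → All (_< M) w → Blocks M bs → Blocks p ((M , w) ∷ bs)
block′ p<M below rest@(final _ _) = block p<M below rest
block′ p<M below rest@(block _ _ _) = block p<M below rest

next-max-> : ∀ {M M′ w bs} → Blocks M ((M′ , w) ∷ bs) → M < M′
next-max-> (final M<M′ _) = M<M′
next-max-> (block M<M′ _ _) = M<M′

lastMax-> : ∀ {p bs} → Blocks p bs → p < lastMax bs
lastMax-> (final p<M _) = p<M
lastMax-> (block p<M _ rest) = <-trans p<M (lastMax-> rest)

lastMax-bounds : ∀ {p bs} → Blocks p bs → All (_≤ lastMax bs) (flatten bs)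
lastMax-bounds (final _ below) = ≤-refl ∷ All-++⁺ (All.map <⇒≤ below) []
lastMax-bounds (block _ below rest) =
  <⇒≤ M<L ∷ All-++⁺ (All.map (λ x<M → <⇒≤ (<-trans x<M M<L)) below) (lastMax-bounds rest)
  where M<L = lastMax-> rest

lastMax-∈ : ∀ {p bs} → Blocks p bs → lastMax bs ∈ flatten bs
lastMax-∈ (final _ _) = here refl
lastMax-∈ (block {w = w} _ _ rest) = there (∈-++⁺ʳ w (lastMax-∈ rest))

flatten-blocksFrom : ∀ M acc ys → flatten (blocksFrom M acc ys) ≡ M ∷ reverse acc ++ ys
flatten-blocksFrom M acc [] = refl
flatten-blocksFrom M acc (y ∷ ys) with M <ᵇ y
... | true = cong (λ r → M ∷ reverse acc ++ r) (flatten-blocksFrom y [] ys)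
... | false = begin
    flatten (blocksFrom M (y ∷ acc) ys)  ≡⟨ flatten-blocksFrom M (y ∷ acc) ys ⟩
    M ∷ reverse (y ∷ acc) ++ ys          ≡⟨ cong (λ r → M ∷ r ++ ys) (unfold-reverse y acc) ⟩
    M ∷ (reverse acc ++ y ∷ []) ++ ys    ≡⟨ cong (M ∷_) (++-assoc (reverse acc) (y ∷ []) ys) ⟩
    M ∷ reverse acc ++ y ∷ ys            ∎

blocksFrom-valid : ∀ {p} M acc ys → p < M → All (_< M) acc → Unique (M ∷ ys) → Blocks p (blocksFrom M acc ys)
blocksFrom-valid M acc [] p<M below _ = final p<M (All-resp-↭ (↭-sym (↭-reverse acc)) below)
blocksFrom-valid M acc (y ∷ ys) p<M below ((M≢y ∷ M∉ys) ∷ y∉ys ∷ distinct) with <-cmp M y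
... | tri< M<y _ _ rewrite <ᵇ-true M<y =
  block′ p<M (All-resp-↭ (↭-sym (↭-reverse acc)) below) (blocksFrom-valid y [] ys M<y [] (y∉ys ∷ distinct))
... | tri≈ _ M≡y _ = ⊥-elim (M≢y M≡y)
... | tri> _ _ y<M rewrite <ᵇ-false (<⇒≤ y<M) =
  blocksFrom-valid M (y ∷ acc) ys p<M (y<M ∷ below) (M∉ys ∷ distinct)

-- Consequences of avoiding 3214 and 4213

<-numeral : ∀ {m n} {_ : T (m <ᵇ n)} → m < n
<-numeral {m} {n} {m<ᵇn} = <ᵇ⇒< m n m<ᵇn

same-order-< : ∀ {a b c d : ℕ} → a < b → c < d → ((a < b) ⇔ (c < d)) × ((b < a) ⇔ (d < c))
same-order-< a<b c<d =
  mk⇔ (λ _ → c<d) (λ _ → a<b) ,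
  mk⇔ (λ b<a → ⊥-elim (<-asym a<b b<a)) (λ d<c → ⊥-elim (<-asym c<d d<c))

same-order-> : ∀ {a b c d : ℕ} → b < a → d < c → ((a < b) ⇔ (c < d)) × ((b < a) ⇔ (d < c))
same-order-> b<a d<c =
  mk⇔ (λ a<b → ⊥-elim (<-asym b<a a<b)) (λ c<d → ⊥-elim (<-asym d<c c<d)) ,
  mk⇔ (λ _ → d<c) (λ _ → b<a)

occurrence-3214 : ∀ {M x y M′} → y < x → x < M → M < M′ → OrderIso (M ∷ x ∷ y ∷ M′ ∷ []) p3214
occurrence-3214 y<x x<M M<M′ =
  (same-order-> x<M <-numeral ∷ same-order-> (<-trans y<x x<M) <-numeral ∷ same-order-< M<M′ <-numeral ∷ []) ,
  (same-order-> y<x <-numeral ∷ same-order-< (<-trans x<M M<M′) <-numeral ∷ []) ,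
  (same-order-< (<-trans y<x (<-trans x<M M<M′)) <-numeral ∷ []) , [] , tt

occurrence-4213 : ∀ {M x y z} → y < x → x < z → z < M → OrderIso (M ∷ x ∷ y ∷ z ∷ []) p4213
occurrence-4213 y<x x<z z<M =
  (same-order-> (<-trans x<z z<M) <-numeral ∷ same-order-> (<-trans y<x (<-trans x<z z<M)) <-numeral ∷
   same-order-> z<M <-numeral ∷ []) ,
  (same-order-> y<x <-numeral ∷ same-order-< x<z <-numeral ∷ []) ,
  (same-order-< (<-trans y<x x<z) <-numeral ∷ []) , [] , tt

-- A word between two maxima M < M′ increases if M w M′ avoids 3214:
-- a descent x > y in w would give the occurrence M x y M′.
increasing-word : ∀ {M M′} w → M < M′ → All (_< M) w → Unique w →
  Avoids (M ∷ w ++ M′ ∷ []) p3214 → Linked _<_ w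
increasing-word [] _ _ _ _ = []
increasing-word (_ ∷ []) _ _ _ _ = [-]
increasing-word {M} {M′} (x ∷ y ∷ ys) M<M′ (x<M ∷ below) ((x≢y ∷ _) ∷ distinct) avoids with <-cmp x y
... | tri< x<y _ _ = x<y ∷ increasing-word (y ∷ ys) M<M′ below distinct (avoids-⊆ (refl ∷ x ∷ʳ ⊆-refl) avoids)
... | tri≈ _ x≡y _ = ⊥-elim (x≢y x≡y)
... | tri> _ _ y<x = ⊥-elim (avoids (M ∷ x ∷ y ∷ M′ ∷ [] , occurrence , occurrence-3214 y<x x<M M<M′))
  where occurrence = refl ∷ refl ∷ refl ∷ ++⁺ˡ ys ⊆-refl

-- In a word after its maximum M avoiding 4213, a descent top x > y exceeds every later
-- entry z: otherwise M x y z would be an occurrence.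
descent-top-dominates : ∀ {M x y} zs → y < x → All (_< M) zs → All (x ≢_) zs →
  Avoids (M ∷ x ∷ y ∷ zs) p4213 → All (_< x) zs
descent-top-dominates [] _ _ _ _ = []
descent-top-dominates {M} {x} {y} (z ∷ zs) y<x (z<M ∷ below) (x≢z ∷ x∉zs) avoids with <-cmp z x
... | tri< z<x _ _ =
  z<x ∷ descent-top-dominates zs y<x below x∉zs (avoids-⊆ (refl ∷ refl ∷ refl ∷ z ∷ʳ ⊆-refl) avoids)
... | tri≈ _ z≡x _ = ⊥-elim (x≢z (sym z≡x))
... | tri> _ _ x<z = ⊥-elim (avoids (M ∷ x ∷ y ∷ z ∷ [] , occurrence , occurrence-4213 y<x x<z z<M))
  where occurrence = refl ∷ refl ∷ refl ∷ refl ∷ minimum zs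

allBelow-true : ∀ {x} zs → All (_< x) zs → allBelow x zs ≡ true
allBelow-true [] _ = refl
allBelow-true (_ ∷ zs) (z<x ∷ below) rewrite <ᵇ-true z<x = allBelow-true zs below

countD-Qword : ∀ {M} w → All (_< M) w → Unique w → Avoids (M ∷ w) p4213 → count D (Qword w) ≡ asc w
countD-Qword [] _ _ _ = refl
countD-Qword (_ ∷ []) _ _ _ = refl
countD-Qword {M} (x ∷ y ∷ ys) (_ ∷ below@(_ ∷ ys<M)) ((x≢y ∷ x∉ys) ∷ distinct) avoids with <-cmp x y
... | tri< x<y _ _ rewrite <ᵇ-false (<⇒≤ x<y) | <ᵇ-true x<y = cong suc rest
  where rest = countD-Qword (y ∷ ys) below distinct (avoids-⊆ (refl ∷ x ∷ʳ ⊆-refl) avoids)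
... | tri≈ _ x≡y _ = ⊥-elim (x≢y x≡y)
... | tri> _ _ y<x rewrite <ᵇ-true y<x | <ᵇ-false (<⇒≤ y<x)
                         | allBelow-true ys (descent-top-dominates ys y<x ys<M x∉ys avoids) = rest
  where rest = countD-Qword (y ∷ ys) below distinct (avoids-⊆ (refl ∷ x ∷ʳ ⊆-refl) avoids)

-- The ascent formulas, block by block

pathBlocks-block : ∀ p M w b bs →
  pathBlocks p ((M , w) ∷ b ∷ bs) ≡ replicate (M ∸ p) U ++ replicate (suc (length w)) D ++ pathBlocks M (b ∷ bs)
pathBlocks-block p M [] b bs = refl
pathBlocks-block p M w@(_ ∷ _) b bs =
  cong (λ k → replicate (M ∸ p) U ++ replicate k D ++ pathBlocks M (b ∷ bs)) (+-comm (length w) 1)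

pathBlocks-startsUp : ∀ {p bs} → Blocks p bs → StartsUp (pathBlocks p bs)
pathBlocks-startsUp (final {w = []} _ _) = empty
pathBlocks-startsUp (final {w = _ ∷ _} p<M _) = startsUp-Uᵏ _ (m<n⇒0<n∸m p<M)
pathBlocks-startsUp (block {p} {M} {w} {M′} {w′} {bs} p<M _ _) =
  subst StartsUp (sym (pathBlocks-block p M w (M′ , w′) bs)) (startsUp-Uᵏ _ (m<n⇒0<n∸m p<M))

-- A non-final block M w contributes the |w| ∸ 1 ascents of its increasing word and the
-- ascent into the next maximum.
asc-block : ∀ {p M w M′ w′ bs} → Blocks p ((M , w) ∷ (M′ , w′) ∷ bs) →
  Unique (flatten ((M , w) ∷ (M′ , w′) ∷ bs)) → Avoids (flatten ((M , w) ∷ (M′ , w′) ∷ bs)) p3214 →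
  asc (flatten ((M , w) ∷ (M′ , w′) ∷ bs)) ≡ length w ∸ 1 + 1 + asc (flatten ((M′ , w′) ∷ bs))
asc-block {M = M} {w} {M′} {w′} {bs} (block _ below rest) distinct avoids = begin
    asc (M ∷ w ++ M′ ∷ r)
  ≡⟨ asc-join M w r (M<M′ ∷ All.map (λ x<M → <-trans x<M M<M′) below) ⟩
    asc (M ∷ w) + 1 + asc (M′ ∷ r)
  ≡⟨ cong (λ a → a + 1 + asc (M′ ∷ r)) (trans (asc-below-head w below) (asc-increasing increasing)) ⟩
    length w ∸ 1 + 1 + asc (M′ ∷ r)
  ∎
  where
    r = w′ ++ flatten bs
    M<M′ = next-max-> rest
    increasing = increasing-word w M<M′ below (unique-⊆ (M ∷ʳ ++⁺ʳ (M′ ∷ r) ⊆-refl) distinct)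
                   (avoids-⊆ (refl ∷ ++⁺ ⊆-refl (refl ∷ minimum r)) avoids)

asc-dyck : ∀ {p bs} → Blocks p bs → lastWord bs ≡ [] → Unique (flatten bs) → Avoids (flatten bs) p3214 →
  asc (flatten bs) ≡ dyckStat (pathBlocks p bs)
asc-dyck (final _ _) refl _ _ = refl
asc-dyck {p} bs@(block {M = M} {w} {M′} {w′} {rest} _ _ tail) final-empty distinct avoids = begin
    asc (flatten all)
  ≡⟨ asc-block bs distinct avoids ⟩
    length w ∸ 1 + 1 + asc (flatten next)
  ≡⟨ cong (length w ∸ 1 + 1 +_)
       (asc-dyck tail final-empty (unique-⊆ (suffix-⊆ M w) distinct) (avoids-⊆ (suffix-⊆ M w) avoids)) ⟩
    length w ∸ 1 + 1 + dyckStat (pathBlocks M next)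
  ≡⟨ sym (dyckStat-mountain (M ∸ p) (length w) (pathBlocks-startsUp tail)) ⟩
    dyckStat (replicate (M ∸ p) U ++ replicate (suc (length w)) D ++ pathBlocks M next)
  ≡⟨ cong dyckStat (sym (pathBlocks-block p M w (M′ , w′) rest)) ⟩
    dyckStat (pathBlocks p all)
  ∎
  where
    next = (M′ , w′) ∷ rest
    all = (M , w) ∷ next

-- The path of a decomposition with nonempty final word, split at the last step of the
-- final up-run (the cut step when p = 0), with its ascents given by the cut statistic.
record Cut (p : ℕ) (bs : List (ℕ × List ℕ)) : Set where
  field
    before after : List Step
    splits  : pathBlocks p bs ≡ before ++ U ∷ after
    ups     : count U before + suc p ≡ lastMax bs
    ascents : asc (flatten bs) ≡ cutStat before after

∸-pred : ∀ {p M} → p < M → M ∸ p ≡ suc (M ∸ suc p)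
∸-pred {zero} {suc M} _ = refl
∸-pred {suc p} {suc M} (s≤s p<M) = ∸-pred p<M

Uᵏ-snoc : ∀ k q → replicate (suc k) U ++ q ≡ replicate k U ++ U ∷ q
Uᵏ-snoc zero q = refl
Uᵏ-snoc (suc k) q = cong (U ∷_) (Uᵏ-snoc k q)

climb : ∀ {p M} c → p ≤ M → M ∸ p + c + p ≡ c + M
climb {p} {M} c p≤M = begin
    M ∸ p + c + p    ≡⟨ cong (_+ p) (+-comm (M ∸ p) c) ⟩
    c + (M ∸ p) + p  ≡⟨ +-assoc c (M ∸ p) p ⟩
    c + (M ∸ p + p)  ≡⟨ cong (c +_) (m∸n+n≡m p≤M) ⟩
    c + M            ∎

-- With nonempty final word: the final block supplies the cut step and the Q-word, each
-- earlier block a mountain in front of it.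
cut-decomposition : ∀ {p bs y ys} → Blocks p bs → lastWord bs ≡ y ∷ ys → Unique (flatten bs) →
  Avoids (flatten bs) p3214 → Avoids (flatten bs) p4213 → Cut p bs
cut-decomposition {p} (final {M = M} {w = w} p<M below) refl distinct _ avoids = record
  { before = replicate k U
  ; after = Qword w
  ; splits = trans (cong (λ j → replicate j U ++ Qword w) (∸-pred p<M)) (Uᵏ-snoc k (Qword w))
  ; ups = begin
      count U (replicate k U) + suc p       ≡⟨ cong (λ q → count U q + suc p) (sym (++-identityʳ (replicate k U))) ⟩
      count U (replicate k U ++ []) + suc p ≡⟨ cong (_+ suc p) (trans (countU-Uᵏ k []) (+-identityʳ k)) ⟩
      k + suc p                             ≡⟨ m∸n+n≡m p<M ⟩
      M                                     ∎
  ; ascents = begin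
      asc (M ∷ w ++ [])       ≡⟨ cong (λ v → asc (M ∷ v)) (++-identityʳ w) ⟩
      asc (M ∷ w)             ≡⟨ asc-below-head w below ⟩
      asc w                   ≡⟨ sym (countD-Qword w below distinct-w (avoids-⊆ (refl ∷ ++⁺ʳ [] ⊆-refl) avoids)) ⟩
      count D (Qword w)       ≡⟨ cong (_+ count D (Qword w)) (cong₂ _+_ (sym (occurrences-Uᵏ (U ∷ []) k (U ∷ []))) (sym no-DDD)) ⟩
      cutStat (replicate k U) (Qword w) ∎
  }
  where
    k = M ∸ suc p
    distinct-w = unique-⊆ (M ∷ʳ ++⁺ʳ [] ⊆-refl) distinct
    no-DDD : tripleDescents (replicate k U) ≡ 0
    no-DDD = trans (cong tripleDescents (sym (++-identityʳ (replicate k U)))) (occurrences-Uᵏ (D ∷ D ∷ []) k [])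
cut-decomposition {p} (block {M = M} {w} {M′} {w′} {rest} p<M below tail) final-word distinct avoids3214 avoids4213 =
  record
  { before = X ++ Y ++ before
  ; after = after
  ; splits = begin
      pathBlocks p all                  ≡⟨ pathBlocks-block p M w (M′ , w′) rest ⟩
      X ++ Y ++ pathBlocks M next       ≡⟨ cong (λ q → X ++ Y ++ q) splits ⟩
      X ++ Y ++ before ++ U ∷ after     ≡⟨ sym (++-assoc₃ X Y before (U ∷ after)) ⟩
      (X ++ Y ++ before) ++ U ∷ after   ∎
  ; ups = begin
      count U (X ++ Y ++ before) + suc p
        ≡⟨ cong (_+ suc p) (trans (countU-Uᵏ d _) (cong (d +_) (countU-Dᵏ (suc l) before))) ⟩
      d + count U before + suc p           ≡⟨ +-suc (d + count U before) p ⟩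
      suc (d + count U before + p)         ≡⟨ cong suc (climb (count U before) (<⇒≤ p<M)) ⟩
      suc (count U before + M)             ≡⟨ sym (+-suc (count U before) M) ⟩
      count U before + suc M               ≡⟨ ups ⟩
      lastMax next                         ∎
  ; ascents = begin
      asc (flatten all)                    ≡⟨ asc-block (block p<M below tail) distinct avoids3214 ⟩
      l ∸ 1 + 1 + asc (flatten next)       ≡⟨ cong (l ∸ 1 + 1 +_) ascents ⟩
      l ∸ 1 + 1 + cutStat before after     ≡⟨ sym (cutStat-mountain d l before after
                                                     (subst StartsUp splits (pathBlocks-startsUp tail))) ⟩
      cutStat (X ++ Y ++ before) after     ∎
  }
  where
    next = (M′ , w′) ∷ rest
    all = (M , w) ∷ next
    d = M ∸ p
    l = length w
    X = replicate d U
    Y = replicate (suc l) D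
    open Cut (cut-decomposition tail final-word (unique-⊆ (suffix-⊆ M w) distinct)
                (avoids-⊆ (suffix-⊆ M w) avoids3214) (avoids-⊆ (suffix-⊆ M w) avoids4213))

-- When Φ₁(σ) is a Dyck path

countU-block : ∀ p M w b bs → count U (pathBlocks p ((M , w) ∷ b ∷ bs)) ≡ M ∸ p + count U (pathBlocks M (b ∷ bs))
countU-block p M w b bs =
  trans (cong (count U) (pathBlocks-block p M w b bs))
        (trans (countU-Uᵏ (M ∸ p) _) (cong (M ∸ p +_) (countU-Dᵏ (suc (length w)) (pathBlocks M (b ∷ bs)))))

countD-block : ∀ p M w b bs →
  count D (pathBlocks p ((M , w) ∷ b ∷ bs)) ≡ suc (length w) + count D (pathBlocks M (b ∷ bs))
countD-block p M w b bs =
  trans (cong (count D) (pathBlocks-block p M w b bs))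
        (trans (countD-Uᵏ (M ∸ p) _) (countD-Dᵏ (suc (length w)) (pathBlocks M (b ∷ bs))))

countU-dyck : ∀ {p bs} → Blocks p bs → lastWord bs ≡ [] → count U (pathBlocks p bs) + p < lastMax bs
countU-dyck (final p<M _) refl = p<M
countU-dyck {p} (block {M = M} {w} {M′} {w′} {rest} p<M _ tail) final-empty =
  subst (_< lastMax ((M′ , w′) ∷ rest))
        (sym (trans (cong (_+ p) (countU-block p M w (M′ , w′) rest)) (climb _ (<⇒≤ p<M))))
        (countU-dyck tail final-empty)

countD-dyck : ∀ {p bs} → Blocks p bs → lastWord bs ≡ [] → suc (count D (pathBlocks p bs)) ≡ length (flatten bs)
countD-dyck (final _ _) refl = refl
countD-dyck {p} (block {M = M} {w} {M′} {w′} {rest} _ _ tail) final-empty = begin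
    suc (count D (pathBlocks p ((M , w) ∷ next)))   ≡⟨ cong suc (countD-block p M w (M′ , w′) rest) ⟩
    suc (suc (length w) + c)                       ≡⟨ cong suc (sym (+-suc (length w) c)) ⟩
    suc (length w + suc c)                         ≡⟨ cong (λ m → suc (length w + m)) (countD-dyck tail final-empty) ⟩
    suc (length w + length (flatten next))         ≡⟨ cong suc (sym (length-++ w)) ⟩
    length (flatten ((M , w) ∷ next))              ∎
  where
    next = (M′ , w′) ∷ rest
    c = count D (pathBlocks M next)

Above : ℕ → List Step → Set
Above h q = ∀ q₁ q₂ → q ≡ q₁ ++ q₂ → count D q₁ ≤ h + count U q₁

above-[] : ∀ {h} → Above h []
above-[] [] _ _ = z≤n

above-Uᵏ : ∀ k {h q} → Above (k + h) q → Above h (replicate k U ++ q)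
above-Uᵏ zero above = above
above-Uᵏ (suc k) above [] _ _ = z≤n
above-Uᵏ (suc k) {h} {q} above (U ∷ q₁) q₂ eq =
  subst (count D q₁ ≤_) (sym (+-suc h (count U q₁)))
        (above-Uᵏ k (subst (λ h′ → Above h′ q) (sym (+-suc k h)) above) q₁ q₂ (∷-injectiveʳ eq))

above-Dᵏ : ∀ k {h q} → Above h q → Above (k + h) (replicate k D ++ q)
above-Dᵏ zero above = above
above-Dᵏ (suc k) above [] _ _ = z≤n
above-Dᵏ (suc k) above (D ∷ q₁) q₂ eq = s≤s (above-Dᵏ k above q₁ q₂ (∷-injectiveʳ eq))

-- Invariant: the entries pre
-- read so far are distinct, positive and at most p, and the path of bs starts at height
-- h = p − |pre|. After the block M w the height is M − |pre M w|, which is nonnegative by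
-- the pigeonhole principle since pre M w consists of distinct values in {1,…,M}.
path-above : ∀ {p bs} pre {h} → Blocks p bs → lastWord bs ≡ [] → Unique (pre ++ flatten bs) →
  All (0 <_) (pre ++ flatten bs) → All (_≤ p) pre → h + length pre ≡ p → Above h (pathBlocks p bs)
path-above pre (final _ _) refl _ _ _ _ = above-[]
path-above {p} pre {h} (block {M = M} {w} {M′} {w′} {rest} p<M below tail) final-empty distinct positive bounded height =
  subst (Above h) (sym (pathBlocks-block p M w (M′ , w′) rest))
    (above-Uᵏ (M ∸ p) (subst (λ h₀ → Above h₀ (replicate (suc l) D ++ pathBlocks M ((M′ , w′) ∷ rest))) heights
      (above-Dᵏ (suc l) (path-above pre′ tail final-empty distinct′ positive′ bounded′ height′))))
  where
    l = length w
    pre′ = pre ++ M ∷ w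
    regroup : pre′ ++ flatten ((M′ , w′) ∷ rest) ≡ pre ++ flatten ((M , w) ∷ (M′ , w′) ∷ rest)
    regroup = ++-assoc pre (M ∷ w) _
    distinct′ = subst Unique (sym regroup) distinct
    positive′ = subst (All (0 <_)) (sym regroup) positive
    bounded′ : All (_≤ M) pre′
    bounded′ = All-++⁺ (All.map (λ x≤p → ≤-trans x≤p (<⇒≤ p<M)) bounded) (≤-refl ∷ All.map <⇒≤ below)
    pigeonhole : length pre′ ≤ M
    pigeonhole = unique-bounded-length (unique-⊆ (++⁺ʳ _ ⊆-refl) distinct′)
                   (All.zip (All-resp-⊆ (++⁺ʳ _ ⊆-refl) positive′ , bounded′))
    h′ = M ∸ length pre′
    height′ : h′ + length pre′ ≡ M
    height′ = m∸n+n≡m pigeonhole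
    -- both heights, raised by |pre|, equal M
    heights : suc l + h′ ≡ M ∸ p + h
    heights = +-cancelʳ-≡ (length pre) _ _ (trans after-block (sym before-block))
      where
        rearrange : ∀ l h′ n → suc l + h′ + n ≡ h′ + (n + suc l)
        rearrange = solve-∀
        after-block : suc l + h′ + length pre ≡ M
        after-block = begin
          suc l + h′ + length pre     ≡⟨ rearrange l h′ (length pre) ⟩
          h′ + (length pre + suc l)   ≡⟨ cong (h′ +_) (sym (length-++ pre)) ⟩
          h′ + length pre′            ≡⟨ height′ ⟩
          M                           ∎
        before-block : M ∸ p + h + length pre ≡ M
        before-block = begin
          M ∸ p + h + length pre      ≡⟨ +-assoc (M ∸ p) h (length pre) ⟩
          M ∸ p + (h + length pre)    ≡⟨ cong (M ∸ p +_) height ⟩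
          M ∸ p + p                   ≡⟨ m∸n+n≡m (<⇒≤ p<M) ⟩
          M                           ∎

length-Qword : ∀ x w → length (Qword (x ∷ w)) ≡ length w
length-Qword x [] = refl
length-Qword x (y ∷ w) = cong suc (length-Qword y w)

-- With nonempty final word at least two entries are not matched by down steps: M_k, and
-- the last entry of w_k, after which Q has no step.
countD-cut : ∀ {p bs y ys} → Blocks p bs → lastWord bs ≡ y ∷ ys →
  count D (pathBlocks p bs) + 2 ≤ length (flatten bs)
countD-cut {p} (final {M = M} {w = y ∷ ys} _ _) refl =
  subst₂ _≤_ (cong (_+ 2) (sym (countD-Uᵏ (M ∸ p) Q))) entries (+-monoˡ-≤ 2 downs≤)
  where
    Q = Qword (y ∷ ys)
    downs≤ : count D Q ≤ length ys
    downs≤ = ≤-trans (m≤n+m (count D Q) (count U Q)) (≤-reflexive (trans (countU+countD Q) (length-Qword y ys)))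
    entries : length ys + 2 ≡ length (M ∷ (y ∷ ys) ++ [])
    entries = trans (+-comm (length ys) 2) (cong (λ v → length (M ∷ v)) (sym (++-identityʳ (y ∷ ys))))
countD-cut {p} (block {M = M} {w} {M′} {w′} {rest} _ _ tail) final-word =
  subst₂ _≤_ (cong (_+ 2) (sym (countD-block p M w (M′ , w′) rest))) (cong suc (sym (length-++ w)))
    (s≤s (≤-trans (≤-reflexive (+-assoc (length w) _ 2)) (+-monoʳ-≤ (length w) (countD-cut tail final-word))))

record Decomposition (n : ℕ) (bs : List (ℕ × List ℕ)) : Set where
  field
    valid      : Blocks 0 bs
    distinct   : Unique (flatten bs)
    positive   : All (0 <_) (flatten bs)
    avoids3214 : Avoids (flatten bs) p3214
    avoids4213 : Avoids (flatten bs) p4213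
    size       : length (flatten bs) ≡ suc n
    top        : lastMax bs ≡ suc n

decompose : ∀ n σ → length σ ≡ suc n → InAvT1 σ → Decomposition n (blocks σ) × flatten (blocks σ) ≡ σ
decompose n (x ∷ xs) len (perm , avoids3214 , _ , avoids4213 , _) = record
  { valid = valid
  ; distinct = subst Unique (sym flat) (perm-unique perm)
  ; positive = subst (All (0 <_)) (sym flat) (All.tabulate (λ y∈σ → proj₁ (perm-range perm y∈σ)))
  ; avoids3214 = subst (λ τ → Avoids τ p3214) (sym flat) avoids3214
  ; avoids4213 = subst (λ τ → Avoids τ p4213) (sym flat) avoids4213
  ; size = trans (cong length flat) len
  ; top = ≤-antisym (proj₂ (perm-range perm′ (subst (lastMax bs ∈_) flat (lastMax-∈ valid))))
                    (All.lookup (lastMax-bounds valid) (subst (suc n ∈_) (sym flat) (perm-top perm′)))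
  } , flat
  where
    bs = blocksFrom x [] xs
    flat : flatten bs ≡ x ∷ xs
    flat = flatten-blocksFrom x [] xs
    perm′ : x ∷ xs ↭ map suc (upTo (suc n))
    perm′ = subst (λ N → x ∷ xs ↭ map suc (upTo N)) len perm
    valid : Blocks 0 bs
    valid = blocksFrom-valid x [] xs (proj₁ (perm-range perm (here refl))) [] (perm-unique perm)

dyck-case : ∀ {n bs} → Decomposition n bs → lastWord bs ≡ [] →
  IsDyckPath (pathBlocks 0 bs) × asc (flatten bs) ≡ dyckStat (pathBlocks 0 bs)
dyck-case {n} {bs} dec final-empty = (prefix , balanced) , asc-dyck valid final-empty distinct avoids3214
  where
    open Decomposition dec
    P = pathBlocks 0 bs
    prefix : IsDyckPrefix P
    prefix = path-above [] valid final-empty distinct positive [] refl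
    ups : count U P ≤ n
    ups = ≤-pred (subst₂ _<_ (+-identityʳ (count U P)) top (countU-dyck valid final-empty))
    downs : count D P ≡ n
    downs = suc-injective (trans (countD-dyck valid final-empty) size)
    balanced : count U P ≡ count D P
    balanced = ≤-antisym (subst (count U P ≤_) (sym downs) ups) (prefix P [] (sym (++-identityʳ P)))

-- Otherwise Φ₁ is not a Dyck path (at least n + 1 up steps, at most n − 1 down steps), and
-- the split at the cut step gives the cut formula.
cut-case : ∀ {n bs y ys} → Decomposition n bs → lastWord bs ≡ y ∷ ys →
  ¬ IsDyckPath (pathBlocks 0 bs)
  × ∃₂ λ a b → pathBlocks 0 bs ≡ a ++ U ∷ b × count U a ≡ n × asc (flatten bs) ≡ cutStat a b
cut-case {n} {bs} dec final-word = not-dyck , before , after , splits , ups≡n , ascents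
  where
    open Decomposition dec
    open Cut (cut-decomposition valid final-word distinct avoids3214 avoids4213)
    P = pathBlocks 0 bs
    ups≡n : count U before ≡ n
    ups≡n = suc-injective (trans (+-comm 1 (count U before)) (trans ups top))
    many-ups : suc n ≤ count U P
    many-ups = subst₂ _≤_ (cong suc ups≡n)
      (trans (sym (+-suc (count U before) (count U after)))
             (sym (trans (cong (count U) splits) (count-++ U before (U ∷ after)))))
      (s≤s (m≤m+n (count U before) (count U after)))
    few-downs : count D P + 2 ≤ suc n
    few-downs = subst (count D P + 2 ≤_) size (countD-cut valid final-word)
    not-dyck : ¬ IsDyckPath P
    not-dyck (_ , balanced) = m+1+n≰m (count D P) (≤-trans few-downs (subst (suc n ≤_) balanced many-ups))

proposition12 : (n : ℕ) (σ : List ℕ) → length σ ≡ suc n → InAvT1 σ →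
    (IsDyckPath (Φ₁ σ) →
      asc σ ≡ valleys (Φ₁ σ) + tripleDescents (Φ₁ σ) + isNonempty (Φ₁ σ))
    × (¬ IsDyckPath (Φ₁ σ) →
      ∃₂ λ a b → Φ₁ σ ≡ a ++ (U ∷ b) × count U a ≡ n
        × asc σ ≡ valleys (a ++ (U ∷ [])) + tripleDescents a + count D b)
proposition12 n σ len inAv with decompose n σ len inAv | lastWord (blocks σ) in final-word
... | dec , flat | [] with dyck-case dec final-word
...   | is-dyck , ascents =
  (λ _ → subst (λ τ → asc τ ≡ dyckStat (Φ₁ σ)) flat ascents) , (λ not-dyck → ⊥-elim (not-dyck is-dyck))
proposition12 n σ len inAv | dec , flat | _ ∷ _ with cut-case dec final-word
...   | not-dyck , a , b , splits , ups , ascents =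
  (λ is-dyck → ⊥-elim (not-dyck is-dyck)) , (λ _ → a , b , splits , ups , subst (λ τ → asc τ ≡ cutStat a b) flat ascents)
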